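{- Let $k\ge1$, $n\ge1$, and for $\ell\in\{0,1,\dots,k\}$ let $h(\ell)=k\sum_{i=k-\ell+1}^{k}\alpha_i$, where $\alpha_1=1$ and $\alpha_i=1+(i-1)\alpha_{i-1}$. For $p,q\in[n]^k$ let $\phi(p,q)=h(d_H(p,q))$ with $d_H$ the Hamming distance. Let $r^t\in[n]^k$ be a request, let $\mathcal{A}^t\in[n]^k$ be a configuration serving it (i.e. $\mathcal{A}^t_i=r^t_i$ for some $i$), and let $q^{t-1}\in[n]^k$ be the Harmonic Algorithm's configuration before $r^t$. Let $q^t$ be the configuration after the Harmonic Algorithm serves $r^t$: if $q^{t-1}_i=r^t_i$ for some $i$ then $q^t=q^{t-1}$; otherwise an index $i\in[k]$ is chosen uniformly at random and $q^t$ is obtained from $q^{t-1}$ by replacing its $i$-th coordinate by $r^t_i$. Then $$\mathbb{E}\big[\phi(q^{t-1},\mathcal{A}^t)-\phi(q^t,\mathcal{A}^t)\big]\ge d_H(q^{t-1},q^t).$$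
   Context: Configurations in $[n]^k$ represent positions of $k$ servers, one in each of $k$ uniform metric spaces with point set $[n]$; a configuration $q$ serves request $r$ if $q_i=r_i$ for some $i$. Note that given $q^{t-1}$ and $r^t$, the quantity $d_H(q^{t-1},q^t)$ is deterministic ($0$ if $q^{t-1}$ serves $r^t$, and $1$ otherwise). -}

module Defs where

open import Data.Nat as ℕ using (ℕ; zero; suc; _+_; _*_; _∸_; NonZero)
open import Data.Integer as ℤ using (ℤ; +_; 0ℤ)
open import Data.Rational as ℚ using (ℚ)
open import Data.Fin using (Fin; _≟_)
open import Data.Fin.Properties using (any?)
open import Data.List using (List; map; foldr; applyUpTo; allFin)
open import Data.Nat.ListAction using (sum)
open import Data.Product using (∃)
open import Data.Bool using (if_then_else_)
open import Relation.Nullary using (yes; no; ⌊_⌋)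
open import Relation.Binary.PropositionalEquality using (_≡_)

-- α₁ = 1, αᵢ = 1 + (i-1) αᵢ₋₁  (α₀ is never used; set to 0)
α : ℕ → ℕ
α zero = 0
α (suc zero) = 1
α (suc (suc i)) = 1 + suc i * α (suc i)

-- h(ℓ) = k * Σ_{i = k-ℓ+1}^{k} αᵢ   (the list enumerates k-ℓ+1, …, k)
h : (k ℓ : ℕ) → ℕ
h k ℓ = k * sum (map α (applyUpTo (λ j → (k ∸ ℓ) + suc j) ℓ))

Config : ℕ → ℕ → Set
Config n k = Fin k → Fin n

dH : ∀ {n k} → Config n k → Config n k → ℕ
dH {k = k} p q = sum (map (λ i → if ⌊ p i ≟ q i ⌋ then 0 else 1) (allFin k))

φ : ∀ {n k} → Config n k → Config n k → ℕ
φ {k = k} p q = h k (dH p q)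

Serves : ∀ {n k} → Config n k → Config n k → Set
Serves q r = ∃ λ i → q i ≡ r i

update : ∀ {n k} → Config n k → Fin k → Fin n → Config n k
update q i x j = if ⌊ j ≟ i ⌋ then x else q j

-- Harmonic Algorithm: configuration after serving r from q, when the
-- uniformly random index drawn is i (the draw is irrelevant if q serves r)
harmonicStep : ∀ {n k} → Config n k → Config n k → Fin k → Config n k
harmonicStep q r i with any? (λ j → q j ≟ r j)
... | yes _ = q
... | no  _ = update q i (r i)

sumℤ : List ℤ → ℤ
sumℤ = foldr ℤ._+_ 0ℤ

𝔼 : (k : ℕ) .{{_ : NonZero k}} → (Fin k → ℤ) → ℚ
𝔼 k f = sumℤ (map f (allFin k)) ℚ./ k

-- If q misses r, each of the k equally likely moves changes one coordinate, so the expected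
-- movement is 1. Let D = d_H(q, A) and c = k − D. Moving the coordinate where A serves r brings
-- q one step closer to A and gains h(D) − h(D−1) = kα_{c+1}; moving one of the c coordinates
-- where q already agrees with A loses h(D+1) − h(D) = kα_c; any other move does not increase
-- the distance. The total gain is therefore at least kα_{c+1} − c·kα_c = k, as α_{c+1} = 1 + cα_c.
module Submission where

open import Defs
open import Data.Nat using (ℕ; NonZero; _≤_)
open import Data.Integer using (+_; _-_)
open import Data.Rational using (_≥_)

open import Data.Nat using (zero; suc; _+_; _*_; _∸_; _<_; z≤n; s≤s)
open import Data.Nat.Properties
  using ( +-comm; +-assoc; +-identityʳ; +-suc; +-∸-assoc; *-identityʳ; *-zeroʳ; *-distribˡ-+
        ; ≤-refl; ≤-trans; ≤-reflexive; <⇒≤; +-mono-≤; +-monoʳ-≤; +-cancelʳ-≤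
        ; m≤m+n; module ≤-Reasoning; m≤n⇒m<n∨m≡n; m+n≤o⇒n≤o; m+n≤o⇒m≤o∸n; m+n∸n≡m )
open import Data.Nat.Tactic.RingSolver using (solve-∀)
open import Data.Nat.ListAction using (sum)
open import Data.Integer as ℤ using (ℤ)
import Data.Integer.Properties as ℤₚ
open import Data.Integer.Tactic.RingSolver renaming (solve-∀ to solveℤ-∀)
import Data.Rational as ℚ
import Data.Rational.Properties as ℚₚ
import Data.Rational.Unnormalised as ℚᵘ
import Data.Rational.Unnormalised.Properties as ℚᵘₚ
open import Data.Fin using (Fin; zero; suc; _≟_)
open import Data.Fin.Properties using (any?; suc-injective)
open import Data.List using (List; []; _∷_; map; length; applyUpTo; allFin)
open import Data.List.Properties using (map-cong; map-tabulate; length-tabulate)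
open import Data.Product using (_,_)
open import Data.Sum using (inj₁; inj₂)
open import Data.Bool using (if_then_else_)
open import Data.Empty using (⊥-elim-irr)
open import Function using (_∘_; id)
open import Relation.Nullary using (yes; no; ⌊_⌋; contradiction)
open import Relation.Binary.PropositionalEquality

private
  variable
    A : Set
    k n : ℕ

sum-map-+ : (f g : A → ℕ) (xs : List A) →
  sum (map (λ x → f x + g x) xs) ≡ sum (map f xs) + sum (map g xs)
sum-map-+ f g [] = refl
sum-map-+ f g (x ∷ xs) = begin
  f x + g x + sum (map (λ x → f x + g x) xs)  ≡⟨ cong (_+_ (f x + g x)) (sum-map-+ f g xs) ⟩
  f x + g x + (sum (map f xs) + sum (map g xs)) ≡⟨ interchange (f x) (g x) _ _ ⟩
  f x + sum (map f xs) + (g x + sum (map g xs)) ∎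
  where
  open ≡-Reasoning
  interchange : ∀ a b c d → a + b + (c + d) ≡ a + c + (b + d)
  interchange = solve-∀

sum-map-*ˡ : (c : ℕ) (f : A → ℕ) (xs : List A) →
  sum (map (λ x → c * f x) xs) ≡ c * sum (map f xs)
sum-map-*ˡ c f [] = sym (*-zeroʳ c)
sum-map-*ˡ c f (x ∷ xs) =
  trans (cong (_+_ (c * f x)) (sum-map-*ˡ c f xs)) (sym (*-distribˡ-+ c (f x) _))

sum-map-const : (c : ℕ) (xs : List A) → sum (map (λ _ → c) xs) ≡ length xs * c
sum-map-const c [] = refl
sum-map-const c (x ∷ xs) = cong (_+_ c) (sum-map-const c xs)

sum-map-zero : {f : A → ℕ} → (∀ x → f x ≡ 0) → (xs : List A) → sum (map f xs) ≡ 0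
sum-map-zero f≗0 [] = refl
sum-map-zero f≗0 (x ∷ xs) = cong₂ _+_ (f≗0 x) (sum-map-zero f≗0 xs)

sum-map-mono : {f g : A → ℕ} → (∀ x → f x ≤ g x) → (xs : List A) →
  sum (map f xs) ≤ sum (map g xs)
sum-map-mono f≤g [] = ≤-refl
sum-map-mono f≤g (x ∷ xs) = +-mono-≤ (f≤g x) (sum-map-mono f≤g xs)

sumℤ-map-pos : (f : A → ℕ) (xs : List A) → sumℤ (map (λ x → + f x) xs) ≡ + sum (map f xs)
sumℤ-map-pos f [] = refl
sumℤ-map-pos f (x ∷ xs) =
  trans (cong (ℤ._+_ (+ f x)) (sumℤ-map-pos f xs)) (sym (ℤₚ.pos-+ (f x) _))

sumℤ-map-- : (f g : A → ℤ) (xs : List A) →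
  sumℤ (map (λ x → f x - g x) xs) ≡ sumℤ (map f xs) - sumℤ (map g xs)
sumℤ-map-- f g [] = refl
sumℤ-map-- f g (x ∷ xs) =
  trans (cong (ℤ._+_ (f x - g x)) (sumℤ-map-- f g xs)) (interchange (f x) (g x) _ _)
  where
  interchange : ∀ a b c d → a - b ℤ.+ (c - d) ≡ (a ℤ.+ c) - (b ℤ.+ d)
  interchange = solveℤ-∀

m+n≤o⇒+m≤+o-+n : ∀ {m n o} → m + n ≤ o → + m ℤ.≤ + o - + n
m+n≤o⇒+m≤+o-+n {m} {n} {o} m+n≤o
  rewrite ℤₚ.m-n≡m⊖n o n | ℤₚ.⊖-≥ (m+n≤o⇒n≤o m m+n≤o) = ℤ.+≤+ (m+n≤o⇒m≤o∸n m m+n≤o)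

/-monoˡ-≤ : ∀ {a b : ℤ} (k : ℕ) .{{_ : NonZero k}} → a ℤ.≤ b → a ℚ./ k ℚ.≤ b ℚ./ k
/-monoˡ-≤ zero {{k≢0}} _ = ⊥-elim-irr (NonZero.nonZero k≢0)
/-monoˡ-≤ {a} {b} (suc k) a≤b = ℚₚ.toℚᵘ-cancel-≤
  (ℚᵘₚ.≤-respˡ-≃ (ℚᵘₚ.≃-sym (ℚₚ.toℚᵘ-fromℚᵘ (ℚᵘ.mkℚᵘ a k)))
    (ℚᵘₚ.≤-respʳ-≃ (ℚᵘₚ.≃-sym (ℚₚ.toℚᵘ-fromℚᵘ (ℚᵘ.mkℚᵘ b k)))
      (ℚᵘ.*≤* (ℤₚ.*-monoʳ-≤-nonNeg (+ suc k) a≤b))))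

sum-allFin-suc : (u : Fin (suc k) → ℕ) →
  sum (map u (allFin (suc k))) ≡ u zero + sum (map (u ∘ suc) (allFin k))
sum-allFin-suc u =
  cong (λ xs → u zero + sum xs) (trans (map-tabulate suc u) (sym (map-tabulate id (u ∘ suc))))

sum-allFin-const : (c : ℕ) → sum (map (λ _ → c) (allFin k)) ≡ k * c
sum-allFin-const {k} c = trans (sum-map-const c (allFin k)) (cong (_* c) (length-tabulate {n = k} id))

sum-allFin-except : (u v : Fin k → ℕ) (i : Fin k) → (∀ j → j ≢ i → u j ≡ v j) →
  sum (map u (allFin k)) + v i ≡ sum (map v (allFin k)) + u i
sum-allFin-except {suc k} u v zero u≈v = begin
  sum (map u (allFin (suc k))) + v zero          ≡⟨ cong (_+ v zero) (sum-allFin-suc u) ⟩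
  u zero + sum (map (u ∘ suc) (allFin k)) + v zero ≡⟨ cong (λ s → u zero + s + v zero) tails-agree ⟩
  u zero + sum (map (v ∘ suc) (allFin k)) + v zero ≡⟨ swap (u zero) _ (v zero) ⟩
  v zero + sum (map (v ∘ suc) (allFin k)) + u zero ≡⟨ cong (_+ u zero) (sum-allFin-suc v) ⟨
  sum (map v (allFin (suc k))) + u zero          ∎
  where
  open ≡-Reasoning
  tails-agree : sum (map (u ∘ suc) (allFin k)) ≡ sum (map (v ∘ suc) (allFin k))
  tails-agree = cong sum (map-cong (λ j → u≈v (suc j) λ ()) (allFin k))
  swap : ∀ a b c → a + b + c ≡ c + b + a
  swap = solve-∀
sum-allFin-except {suc k} u v (suc i) u≈v = begin
  sum (map u (allFin (suc k))) + v (suc i)          ≡⟨ cong (_+ v (suc i)) (sum-allFin-suc u) ⟩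
  u zero + sum (map (u ∘ suc) (allFin k)) + v (suc i) ≡⟨ +-assoc (u zero) _ _ ⟩
  u zero + (sum (map (u ∘ suc) (allFin k)) + v (suc i))
    ≡⟨ cong₂ _+_ (u≈v zero λ ()) (sum-allFin-except (u ∘ suc) (v ∘ suc) i (λ j j≢i → u≈v (suc j) (j≢i ∘ suc-injective))) ⟩
  v zero + (sum (map (v ∘ suc) (allFin k)) + u (suc i)) ≡⟨ +-assoc (v zero) _ _ ⟨
  v zero + sum (map (v ∘ suc) (allFin k)) + u (suc i) ≡⟨ cong (_+ u (suc i)) (sum-allFin-suc v) ⟨
  sum (map v (allFin (suc k))) + u (suc i)          ∎
  where open ≡-Reasoning

sum-allFin-single : (u : Fin k → ℕ) (i : Fin k) → (∀ j → j ≢ i → u j ≡ 0) →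
  sum (map u (allFin k)) ≡ u i
sum-allFin-single {k} u i u≈0 = begin
  sum (map u (allFin k))                  ≡⟨ +-identityʳ _ ⟨
  sum (map u (allFin k)) + 0              ≡⟨ sum-allFin-except u (λ _ → 0) i u≈0 ⟩
  sum (map (λ _ → 0) (allFin k)) + u i    ≡⟨ cong (_+ u i) (sum-map-zero (λ _ → refl) (allFin k)) ⟩
  u i                                     ∎
  where open ≡-Reasoning

if-≟-≡ : {B : Set} {x y : Fin n} (a b : B) → x ≡ y → (if ⌊ x ≟ y ⌋ then a else b) ≡ a
if-≟-≡ {x = x} {y} a b x≡y with x ≟ y
... | yes _ = refl
... | no x≢y = contradiction x≡y x≢y

if-≟-≢ : {B : Set} {x y : Fin n} (a b : B) → x ≢ y → (if ⌊ x ≟ y ⌋ then a else b) ≡ b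
if-≟-≢ {x = x} {y} a b x≢y with x ≟ y
... | yes x≡y = contradiction x≡y x≢y
... | no _ = refl

match mismatch : Fin n → Fin n → ℕ
match    x y = if ⌊ x ≟ y ⌋ then 1 else 0
mismatch x y = if ⌊ x ≟ y ⌋ then 0 else 1

match-≡ : {x y : Fin n} → x ≡ y → match x y ≡ 1
match-≡ = if-≟-≡ 1 0

match-≢ : {x y : Fin n} → x ≢ y → match x y ≡ 0
match-≢ = if-≟-≢ 1 0

mismatch-≡ : {x y : Fin n} → x ≡ y → mismatch x y ≡ 0
mismatch-≡ = if-≟-≡ 0 1

mismatch-≢ : {x y : Fin n} → x ≢ y → mismatch x y ≡ 1
mismatch-≢ = if-≟-≢ 0 1

match+mismatch≡1 : (x y : Fin n) → match x y + mismatch x y ≡ 1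
match+mismatch≡1 x y with x ≟ y
... | yes _ = refl
... | no _ = refl

mismatch≤1 : (x y : Fin n) → mismatch x y ≤ 1
mismatch≤1 x y = m+n≤o⇒n≤o (match x y) (≤-reflexive (match+mismatch≡1 x y))

update-≡ : (p : Config n k) (i : Fin k) (x : Fin n) → update p i x i ≡ x
update-≡ p i x = if-≟-≡ x (p i) refl

update-≢ : (p : Config n k) {i j : Fin k} (x : Fin n) → j ≢ i → update p i x j ≡ p j
update-≢ p x = if-≟-≢ x (p _)

agreements : Config n k → Config n k → ℕ
agreements {k = k} p q = sum (map (λ i → match (p i) (q i)) (allFin k))

agreements+dH≡k : (p q : Config n k) → agreements p q + dH p q ≡ k
agreements+dH≡k {k = k} p q = begin
  agreements p q + dH p q
    ≡⟨ sum-map-+ (λ i → match (p i) (q i)) (λ i → mismatch (p i) (q i)) (allFin k) ⟨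
  sum (map (λ i → match (p i) (q i) + mismatch (p i) (q i)) (allFin k))
    ≡⟨ cong sum (map-cong (λ i → match+mismatch≡1 (p i) (q i)) (allFin k)) ⟩
  sum (map (λ _ → 1) (allFin k))  ≡⟨ sum-allFin-const {k} 1 ⟩
  k * 1                           ≡⟨ *-identityʳ k ⟩
  k                               ∎
  where open ≡-Reasoning

dH≤k : (p q : Config n k) → dH p q ≤ k
dH≤k p q = m+n≤o⇒n≤o (agreements p q) (≤-reflexive (agreements+dH≡k p q))

dH-refl : (p : Config n k) → dH p p ≡ 0
dH-refl {k = k} p = sum-map-zero (λ i → mismatch-≡ refl) (allFin k)

dH-update : (p q : Config n k) (i : Fin k) (x : Fin n) →
  dH p q + mismatch x (q i) ≡ dH (update p i x) q + mismatch (p i) (q i)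
dH-update p q i x = begin
  dH p q + mismatch x (q i)                  ≡⟨ cong (λ y → dH p q + mismatch y (q i)) (update-≡ p i x) ⟨
  dH p q + mismatch (update p i x i) (q i)   ≡⟨ sum-allFin-except _ _ i agree ⟩
  dH (update p i x) q + mismatch (p i) (q i) ∎
  where
  open ≡-Reasoning
  agree : ∀ j → j ≢ i → mismatch (p j) (q j) ≡ mismatch (update p i x j) (q j)
  agree j j≢i = cong (λ y → mismatch y (q j)) (sym (update-≢ p x j≢i))

dH-update-self : (p : Config n k) (i : Fin k) (x : Fin n) → dH p (update p i x) ≡ mismatch (p i) x
dH-update-self p i x = trans (sum-allFin-single _ i unchanged) (cong (mismatch (p i)) (update-≡ p i x))
  where
  unchanged : ∀ j → j ≢ i → mismatch (p j) (update p i x j) ≡ 0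
  unchanged j j≢i = mismatch-≡ (sym (update-≢ p x j≢i))

α-suc : ∀ c → α (suc c) ≡ 1 + c * α c
α-suc zero = refl
α-suc (suc c) = refl

applyUpTo-cong : {f g : ℕ → A} → (∀ m → f m ≡ g m) → ∀ ℓ → applyUpTo f ℓ ≡ applyUpTo g ℓ
applyUpTo-cong f≗g zero = refl
applyUpTo-cong f≗g (suc ℓ) = cong₂ _∷_ (f≗g 0) (applyUpTo-cong (f≗g ∘ suc) ℓ)

applyUpTo-shift : ∀ s ℓ →
  applyUpTo (λ j → s + suc j) (suc ℓ) ≡ suc s ∷ applyUpTo (λ j → suc s + suc j) ℓ
applyUpTo-shift s ℓ = cong₂ _∷_ (+-comm s 1) (applyUpTo-cong (λ j → +-suc s (suc j)) ℓ)

∸≡suc∸suc : ∀ {ℓ m} → ℓ < m → m ∸ ℓ ≡ suc (m ∸ suc ℓ)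
∸≡suc∸suc {ℓ} (s≤s ℓ≤m) = +-∸-assoc 1 ℓ≤m

h-suc : ∀ {k ℓ} → ℓ < k → h k (suc ℓ) ≡ h k ℓ + k * α (k ∸ ℓ)
h-suc {k} {ℓ} ℓ<k = begin
  h k (suc ℓ)
    ≡⟨ cong (λ xs → k * sum (map α xs)) (applyUpTo-shift (k ∸ suc ℓ) ℓ) ⟩
  k * (α (suc (k ∸ suc ℓ)) + sum (map α (applyUpTo (λ j → suc (k ∸ suc ℓ) + suc j) ℓ)))
    ≡⟨ cong (λ s → k * (α s + sum (map α (applyUpTo (λ j → s + suc j) ℓ)))) (∸≡suc∸suc ℓ<k) ⟨
  k * (α (k ∸ ℓ) + sum (map α (applyUpTo (λ j → (k ∸ ℓ) + suc j) ℓ)))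
    ≡⟨ *-distribˡ-+ k _ _ ⟩
  k * α (k ∸ ℓ) + h k ℓ
    ≡⟨ +-comm _ (h k ℓ) ⟩
  h k ℓ + k * α (k ∸ ℓ) ∎
  where open ≡-Reasoning

h-mono : ∀ {k ℓ m} → ℓ ≤ m → m ≤ k → h k ℓ ≤ h k m
h-mono {m = zero} z≤n _ = ≤-refl
h-mono {k} {ℓ} {suc m} ℓ≤1+m 1+m≤k with m≤n⇒m<n∨m≡n ℓ≤1+m
... | inj₂ refl = ≤-refl
... | inj₁ (s≤s ℓ≤m) = ≤-trans (h-mono ℓ≤m (<⇒≤ 1+m≤k))
                         (≤-trans (m≤m+n (h k m) _) (≤-reflexive (sym (h-suc 1+m≤k))))

module MissedRequest {n k} (r A q : Config n k) (q-misses : ∀ i → q i ≢ r i)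
                     (j : Fin k) (A-hits : A j ≡ r j) where

  D c : ℕ
  D = dH q A
  c = k ∸ D

  moved : Fin k → Config n k
  moved i = update q i (r i)

  dist-moved : ∀ i → D + mismatch (r i) (A i) ≡ dH (moved i) A + mismatch (q i) (A i)
  dist-moved i = dH-update q A i (r i)

  h-moved-hit : h k (dH (moved j) A) + k * α (suc c) ≡ h k D
  h-moved-hit = begin
    h k d + k * α (suc (k ∸ D))       ≡⟨ cong (λ t → h k d + k * α (suc (k ∸ t))) D≡1+d ⟩
    h k d + k * α (suc (k ∸ suc d))   ≡⟨ cong (λ t → h k d + k * α t) (∸≡suc∸suc d<k) ⟨
    h k d + k * α (k ∸ d)             ≡⟨ h-suc d<k ⟨
    h k (suc d)                       ≡⟨ cong (h k) D≡1+d ⟨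
    h k D                             ∎
    where
    open ≡-Reasoning
    d = dH (moved j) A
    D≡1+d : D ≡ suc d
    D≡1+d = begin
      D                               ≡⟨ +-identityʳ D ⟨
      D + 0                           ≡⟨ cong (_+_ D) (mismatch-≡ (sym A-hits)) ⟨
      D + mismatch (r j) (A j)        ≡⟨ dist-moved j ⟩
      d + mismatch (q j) (A j)        ≡⟨ cong (_+_ d) (mismatch-≢ λ qj≡Aj → q-misses j (trans qj≡Aj A-hits)) ⟩
      d + 1                           ≡⟨ +-comm d 1 ⟩
      suc d                           ∎
    d<k : d < k
    d<k = subst (_≤ k) D≡1+d (dH≤k q A)

  h-moved-agree : ∀ i → q i ≡ A i → h k (dH (moved i) A) ≡ h k D + k * α c
  h-moved-agree i qi≡Ai = trans (cong (h k) d≡1+D) (h-suc (subst (_≤ k) d≡1+D (dH≤k (moved i) A)))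
    where
    open ≡-Reasoning
    d = dH (moved i) A
    d≡1+D : d ≡ suc D
    d≡1+D = begin
      d                               ≡⟨ +-identityʳ d ⟨
      d + 0                           ≡⟨ cong (_+_ d) (mismatch-≡ qi≡Ai) ⟨
      d + mismatch (q i) (A i)        ≡⟨ dist-moved i ⟨
      D + mismatch (r i) (A i)        ≡⟨ cong (_+_ D) (mismatch-≢ λ ri≡Ai → q-misses i (trans qi≡Ai (sym ri≡Ai))) ⟩
      D + 1                           ≡⟨ +-comm D 1 ⟩
      suc D                           ∎

  h-moved-other : ∀ i → q i ≢ A i → h k (dH (moved i) A) ≤ h k D
  h-moved-other i qi≢Ai = h-mono (+-cancelʳ-≤ 1 d D d+1≤D+1) (dH≤k q A)
    where
    open ≤-Reasoning
    d = dH (moved i) A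
    d+1≤D+1 : d + 1 ≤ D + 1
    d+1≤D+1 = begin
      d + 1                           ≡⟨ cong (_+_ d) (mismatch-≢ qi≢Ai) ⟨
      d + mismatch (q i) (A i)        ≡⟨ dist-moved i ⟨
      D + mismatch (r i) (A i)        ≤⟨ +-monoʳ-≤ D (mismatch≤1 (r i) (A i)) ⟩
      D + 1                           ∎

  h-moved-bound : ∀ i → h k (dH (moved i) A) + k * α (suc c) * match i j
                          ≤ h k D + k * α c * match (q i) (A i)
  h-moved-bound i with i ≟ j | q i ≟ A i
  ... | yes refl | _
    rewrite *-identityʳ (k * α (suc c)) =
      ≤-trans (≤-reflexive h-moved-hit) (m≤m+n (h k D) _)
  ... | no i≢j | yes qi≡Ai
    rewrite *-zeroʳ (k * α (suc c)) | *-identityʳ (k * α c)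
          | +-identityʳ (h k (dH (moved i) A)) =
      ≤-reflexive (h-moved-agree i qi≡Ai)
  ... | no i≢j | no qi≢Ai
    rewrite *-zeroʳ (k * α (suc c)) | *-zeroʳ (k * α c)
          | +-identityʳ (h k (dH (moved i) A)) | +-identityʳ (h k D) =
      h-moved-other i qi≢Ai

  gain-bound : k + sum (map (λ i → h k (dH (moved i) A)) (allFin k))
                 ≤ sum (map (λ _ → h k D) (allFin k))
  gain-bound = +-cancelʳ-≤ (Y * c) (k + T) H (begin
    k + T + Y * c                   ≡⟨ regroup k T (α c) c ⟩
    T + k * (1 + c * α c)           ≡⟨ cong (λ a → T + k * a) (α-suc c) ⟨
    T + X                           ≡⟨ cong (_+_ T) (*-identityʳ X) ⟨
    T + X * 1                       ≡⟨ cong (λ m → T + X * m) one-hit ⟨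
    T + X * sum (map (λ i → match i j) (allFin k))
      ≡⟨ cong (_+_ T) (sum-map-*ˡ X (λ i → match i j) (allFin k)) ⟨
    T + sum (map (λ i → X * match i j) (allFin k))
      ≡⟨ sum-map-+ (λ i → h k (dH (moved i) A)) (λ i → X * match i j) (allFin k) ⟨
    sum (map (λ i → h k (dH (moved i) A) + X * match i j) (allFin k))
      ≤⟨ sum-map-mono h-moved-bound (allFin k) ⟩
    sum (map (λ i → h k D + Y * match (q i) (A i)) (allFin k))
      ≡⟨ sum-map-+ (λ _ → h k D) (λ i → Y * match (q i) (A i)) (allFin k) ⟩
    H + sum (map (λ i → Y * match (q i) (A i)) (allFin k))
      ≡⟨ cong (_+_ H) (sum-map-*ˡ Y (λ i → match (q i) (A i)) (allFin k)) ⟩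
    H + Y * agreements q A          ≡⟨ cong (λ a → H + Y * a) agreements≡c ⟩
    H + Y * c                       ∎)
    where
    open ≤-Reasoning
    X = k * α (suc c)
    Y = k * α c
    T = sum (map (λ i → h k (dH (moved i) A)) (allFin k))
    H = sum (map (λ _ → h k D) (allFin k))
    regroup : ∀ k T a c → k + T + k * a * c ≡ T + k * (1 + c * a)
    regroup = solve-∀
    one-hit : sum (map (λ i → match i j) (allFin k)) ≡ 1
    one-hit = trans (sum-allFin-single (λ i → match i j) j (λ i → match-≢)) (match-≡ refl)
    agreements≡c : agreements q A ≡ c
    agreements≡c = trans (sym (m+n∸n≡m (agreements q A) D)) (cong (_∸ D) (agreements+dH≡k q A))

  expected-distance≤expected-gain :
    sumℤ (map (λ i → + dH q (moved i)) (allFin k))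
      ℤ.≤ sumℤ (map (λ i → + φ q A - + φ (moved i) A) (allFin k))
  expected-distance≤expected-gain = begin
    sumℤ (map (λ i → + dH q (moved i)) (allFin k))   ≡⟨ sumℤ-map-pos (λ i → dH q (moved i)) (allFin k) ⟩
    + sum (map (λ i → dH q (moved i)) (allFin k))    ≡⟨ cong (+_ ∘ sum) (map-cong moves-once (allFin k)) ⟩
    + sum (map (λ _ → 1) (allFin k))                 ≡⟨ cong +_ (trans (sum-allFin-const {k} 1) (*-identityʳ k)) ⟩
    + k                                              ≤⟨ m+n≤o⇒+m≤+o-+n gain-bound ⟩
    + sum (map (λ _ → φ q A) (allFin k)) - + sum (map (λ i → φ (moved i) A) (allFin k))
      ≡⟨ cong₂ _-_ (sumℤ-map-pos (λ _ → φ q A) (allFin k)) (sumℤ-map-pos (λ i → φ (moved i) A) (allFin k)) ⟨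
    sumℤ (map (λ _ → + φ q A) (allFin k)) - sumℤ (map (λ i → + φ (moved i) A) (allFin k))
      ≡⟨ sumℤ-map-- (λ _ → + φ q A) (λ i → + φ (moved i) A) (allFin k) ⟨
    sumℤ (map (λ i → + φ q A - + φ (moved i) A) (allFin k)) ∎
    where
    open ℤₚ.≤-Reasoning
    moves-once : ∀ i → dH q (moved i) ≡ 1
    moves-once i = trans (dH-update-self q i (r i)) (mismatch-≢ (q-misses i))

harmonic-distance≤gain : (r A q : Config n k) → Serves A r →
  sumℤ (map (λ i → + dH q (harmonicStep q r i)) (allFin k))
    ℤ.≤ sumℤ (map (λ i → + φ q A - + φ (harmonicStep q r i) A) (allFin k))
-- Abstracting the decision that harmonicStep branches on makes the step reduce to q or to moved i.
harmonic-distance≤gain {k = k} r A q (j , A-hits) with any? (λ i → q i ≟ r i)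
... | yes _ = ℤₚ.≤-reflexive (cong sumℤ (map-cong (λ _ → stays) (allFin k)))
  where
  stays : + dH q q ≡ + φ q A - + φ q A
  stays = trans (cong +_ (dH-refl q)) (sym (ℤₚ.+-inverseʳ (+ φ q A)))
... | no q-misses = expected-distance≤expected-gain
  where open MissedRequest r A q (λ i qi≡ri → q-misses (i , qi≡ri)) j A-hits

lemma2 : (k n : ℕ) .{{_ : NonZero k}} → 1 ≤ n →
    (r A q : Config n k) → Serves A r →
    𝔼 k (λ i → + φ q A - + φ (harmonicStep q r i) A)
      ≥ 𝔼 k (λ i → + dH q (harmonicStep q r i))
lemma2 k _ _ r A q A-serves = /-monoˡ-≤ k (harmonic-distance≤gain r A q A-serves)
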